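{- Let $q\ge3$, $n\ge1$, and let $Z\subseteq\mathbb{Z}_q^n$ be a code in $H(n,q)$ any two distinct elements of which are at Hamming distance at least $4$. Then for every vertex $x$ of $H(n,q)$: (1) $w_Z(x)\le1$; (2) if $w_Z(x)=1$, then exactly one of the following holds: $|S_0(x)\cap Z|=1$, $|S_1(x)\cap Z|=0$, $|S_2(x)\cap Z|=0$; or $|S_0(x)\cap Z|=0$, $|S_1(x)\cap Z|=1$, $|S_2(x)\cap Z|=0$; or $|S_0(x)\cap Z|=0$, $|S_1(x)\cap Z|=0$, $|S_2(x)\cap Z|=n/2$.
   Context: $H(n,q)$ is the Hamming graph on $\mathbb{Z}_q^n$ (adjacent iff differing in exactly one coordinate), $d$ the Hamming distance, $S_i(x)=\{y:d(x,y)=i\}$, and $w_Z(x)=|S_0(x)\cap Z|+|S_1(x)\cap Z|+\frac{2}{n}|S_2(x)\cap Z|$. -}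

module Defs where

open import Data.Nat using (ℕ; zero; suc; _+_; _*_; _≡ᵇ_; NonZero)
open import Data.Bool using (Bool; true; false; _∧_; if_then_else_)
open import Data.Fin using (Fin)
open import Data.Fin.Properties using (_≟_)
open import Data.Vec using (Vec; []; _∷_)
open import Data.List using (List; allFin; [_]; concatMap; map; filterᵇ; length)
open import Relation.Nullary using (¬_; does)
open import Relation.Binary.PropositionalEquality using (_≡_)
open import Data.Product using (_×_)
open import Data.Sum using (_⊎_)
open import Data.Integer using (+_)
open import Data.Rational using (ℚ; _/_; _≤_) renaming (_+_ to _+ℚ_)

-- vertices of H(n,q): words of length n over Z_q (represented by Fin q)
Word : ℕ → ℕ → Set
Word q n = Vec (Fin q) n

-- list of all vertices of H(n,q) (each exactly once)
allWords : (q n : ℕ) → List (Word q n)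
allWords q zero = [ [] ]
allWords q (suc n) = concatMap (λ a → map (a ∷_) (allWords q n)) (allFin q)

dist : ∀ {q n} → Word q n → Word q n → ℕ
dist [] [] = 0
dist (a ∷ x) (b ∷ y) = (if does (a ≟ b) then 0 else 1) + dist x y

Code : ℕ → ℕ → Set
Code q n = Word q n → Bool

MinDist4 : ∀ {q n} → Code q n → Set
MinDist4 {q} {n} Z = ∀ (y z : Word q n) → Z y ≡ true → Z z ≡ true → ¬ (y ≡ z) → 4 Data.Nat.≤ dist y z

cnt : ∀ {q n} → Code q n → ℕ → Word q n → ℕ
cnt {q} {n} Z i x = length (filterᵇ (λ y → Z y ∧ (dist x y ≡ᵇ i)) (allWords q n))

w : ∀ {q n} .{{_ : NonZero n}} → Code q n → Word q n → ℚ
w {q} {n} Z x = ((+ (cnt Z 0 x + cnt Z 1 x)) / 1) +ℚ ((+ (2 * cnt Z 2 x)) / n)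

ExactlyOne3 : Set → Set → Set → Set
ExactlyOne3 A B C = (A ⊎ B ⊎ C) × ¬ (A × B) × ¬ (A × C) × ¬ (B × C)

-- Two codewords within distance 3 of each other coincide, so x sees at most one codeword
-- in S_0(x) ∪ S_1(x), and none in S_2(x) as soon as it sees one there.  Codewords y, z ∈ S_2(x)
-- are at distance 4 = d(x,y) + d(x,z), so x lies on a geodesic between them: the coordinates
-- in which y and z differ from x are disjoint, giving 2|S_2(x) ∩ Z| ≤ n, i.e. w_Z(x) ≤ 1.
module Submission where

open import Defs
open import Algebra.Properties.CommutativeSemigroup using (interchange)
open import Data.Bool using (true; false; _∧_; if_then_else_; T; T?)
open import Data.Bool.Properties using (T-∧; T-≡)
open import Data.Empty using (⊥; ⊥-elim)
open import Data.Fin using (Fin)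
open import Data.Fin.Properties using (_≟_)
open import Data.Integer as ℤ using (+_)
import Data.Integer.Properties as ℤ
open import Data.List using (List; []; _∷_; map; length; filterᵇ; allFin; concatMap; cartesianProductWith; _++_)
open import Data.List.Relation.Unary.All as All using (All; []; _∷_)
import Data.List.Relation.Unary.All.Properties as All
open import Data.List.Relation.Unary.AllPairs as AllPairs using (AllPairs; []; _∷_)
import Data.List.Relation.Unary.AllPairs.Properties as AllPairs
open import Data.List.Relation.Unary.Unique.Propositional using (Unique)
import Data.List.Relation.Unary.Unique.Propositional.Properties as Unique
open import Data.Nat as ℕ using (ℕ; zero; suc; _+_; _*_; _≤_; _<_; _≥_; _≡ᵇ_; z≤n; s≤s; s<s; z<s; NonZero)
open import Data.Nat.ListAction using (sum)
open import Data.Nat.Properties as ℕ using (+-commutativeSemigroup)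
open import Data.Product using (_×_; _,_; proj₂)
open import Data.Rational as ℚ using (ℚ; _/_; 1ℚ) renaming (_+_ to _+ℚ_)
import Data.Rational.Properties as ℚ
open import Data.Rational.Unnormalised as ℚᵘ using (ℚᵘ; mkℚᵘ; *≤*; *≡*)
import Data.Rational.Unnormalised.Properties as ℚᵘ
open import Data.Sum using (_⊎_; inj₁; inj₂)
open import Data.Vec using (_∷_; []; head; tail)
open import Data.Vec.Properties using (∷-injective)
open import Function using (_∘_; Equivalence)
open import Relation.Binary.PropositionalEquality using (_≡_; _≢_; refl; sym; trans; cong; cong₂; subst; module ≡-Reasoning)
open import Relation.Nullary using (¬_; does; yes; no)

private
  variable
    A : Set
    q n : ℕ

+-interchange : ∀ a b c d → (a + b) + (c + d) ≡ (a + c) + (b + d)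
+-interchange = interchange +-commutativeSemigroup

sum-map-const : ∀ (f : A → ℕ) {k ys} → All (λ y → f y ≡ k) ys → sum (map f ys) ≡ length ys * k
sum-map-const f []         = refl
sum-map-const f (fy≡k ∷ p) = cong₂ _+_ fy≡k (sum-map-const f p)

sum-map-zero : ∀ (f : A → ℕ) {ys} → All (λ y → f y ≡ 0) ys → sum (map f ys) ≡ 0
sum-map-zero f {ys} p = trans (sum-map-const f p) (ℕ.*-zeroʳ (length ys))

sum-≤1 : ∀ (f : A → ℕ) → (∀ y → f y ≤ 1) → ∀ {ys} →
         AllPairs (λ y z → f y + f z ≤ 1) ys → sum (map f ys) ≤ 1
sum-≤1 f f≤1 []               = z≤n
sum-≤1 f f≤1 {y ∷ ys} (p ∷ ps) with f y | f≤1 y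
... | zero        | _ = sum-≤1 f f≤1 ps
... | suc zero    | _ = s≤s (ℕ.≤-reflexive (sum-map-zero f (All.map (ℕ.n≤0⇒n≡0 ∘ ℕ.s≤s⁻¹) p)))
... | suc (suc _) | s≤s ()

mismatch : Fin q → Fin q → ℕ
mismatch a b = if does (a ≟ b) then 0 else 1

mismatch-≤1 : (a b : Fin q) → mismatch a b ≤ 1
mismatch-≤1 a b with does (a ≟ b)
... | true  = z≤n
... | false = s≤s z≤n

mismatch-triangle : (a b c : Fin q) → mismatch b c ≤ mismatch a b + mismatch a c
mismatch-triangle a b c with a ≟ b | a ≟ c
... | yes refl | yes refl = ℕ.≤-reflexive (mismatch-refl a)
  where
  mismatch-refl : (a : Fin q) → mismatch a a ≡ 0
  mismatch-refl a with a ≟ a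
  ... | yes _   = refl
  ... | no a≢a = ⊥-elim (a≢a refl)
... | yes refl | no _ = mismatch-≤1 b c
... | no _     | _    = ℕ.m≤n⇒m≤n+o _ (mismatch-≤1 b c)

dist-triangle : (x y z : Word q n) → dist y z ≤ dist x y + dist x z
dist-triangle [] [] [] = z≤n
dist-triangle (a ∷ x) (b ∷ y) (c ∷ z) = ℕ.≤-trans
  (ℕ.+-mono-≤ (mismatch-triangle a b c) (dist-triangle x y z))
  (ℕ.≤-reflexive (+-interchange (mismatch a b) (mismatch a c) (dist x y) (dist x z)))

Between : Word q n → Word q n → Word q n → Set
Between x y z = dist x y + dist x z ≤ dist y z

Between-head : ∀ a (x : Word q n) {y z} → Between (a ∷ x) y z →
               mismatch a (head y) + mismatch a (head z) ≤ 1
Between-head a x {b ∷ y} {c ∷ z} between = ℕ.+-cancelʳ-≤ (dist x y + dist x z) _ _ (begin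
  (mismatch a b + mismatch a c) + (dist x y + dist x z) ≡⟨ +-interchange (mismatch a b) _ _ _ ⟨
  (mismatch a b + dist x y) + (mismatch a c + dist x z) ≤⟨ between ⟩
  mismatch b c + dist y z                               ≤⟨ ℕ.+-mono-≤ (mismatch-≤1 b c) (dist-triangle x y z) ⟩
  1 + (dist x y + dist x z)                             ∎)
  where open ℕ.≤-Reasoning

Between-tail : ∀ a (x : Word q n) {y z} → Between (a ∷ x) y z → Between x (tail y) (tail z)
Between-tail a x {b ∷ y} {c ∷ z} between = ℕ.+-cancelˡ-≤ (mismatch a b + mismatch a c) _ _ (begin
  (mismatch a b + mismatch a c) + (dist x y + dist x z) ≡⟨ +-interchange (mismatch a b) _ _ _ ⟨
  (mismatch a b + dist x y) + (mismatch a c + dist x z) ≤⟨ between ⟩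
  mismatch b c + dist y z                               ≤⟨ ℕ.+-monoˡ-≤ (dist y z) (mismatch-triangle a b c) ⟩
  (mismatch a b + mismatch a c) + dist y z              ∎)
  where open ℕ.≤-Reasoning

sum-map-dist-∷ : ∀ a (x : Word q n) ys →
  sum (map (dist (a ∷ x)) ys) ≡ sum (map (mismatch a ∘ head) ys) + sum (map (dist x) (map tail ys))
sum-map-dist-∷ a x []             = refl
sum-map-dist-∷ a x ((b ∷ y) ∷ ys) = trans
  (cong (_+_ (mismatch a b + dist x y)) (sum-map-dist-∷ a x ys))
  (+-interchange (mismatch a b) (dist x y) _ _)

-- If x lies between any two of the ys, the coordinates in which the ys differ from x are pairwise disjoint.
sum-dist-≤ : (x : Word q n) {ys : List (Word q n)} → AllPairs (Between x) ys → sum (map (dist x) ys) ≤ n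
sum-dist-≤ [] {ys} _ = ℕ.≤-reflexive (sum-map-zero (dist []) (All.universal (λ { [] → refl }) ys))
sum-dist-≤ (a ∷ x) {ys} between = begin
  sum (map (dist (a ∷ x)) ys)                                          ≡⟨ sum-map-dist-∷ a x ys ⟩
  sum (map (mismatch a ∘ head) ys) + sum (map (dist x) (map tail ys)) ≤⟨ ℕ.+-mono-≤ at-head in-tail ⟩
  1 + _                                                                ∎
  where
  open ℕ.≤-Reasoning
  at-head : sum (map (mismatch a ∘ head) ys) ≤ 1
  at-head = sum-≤1 (mismatch a ∘ head) (mismatch-≤1 a ∘ head)
                   (AllPairs.map (λ {y} {z} → Between-head a x {y} {z}) between)
  in-tail : sum (map (dist x) (map tail ys)) ≤ _
  in-tail = sum-dist-≤ x (AllPairs.map⁺ (AllPairs.map (λ {y} {z} → Between-tail a x {y} {z}) between))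

concatMap-map≡cartesianProductWith : ∀ {B C : Set} (f : A → B → C) xs ys →
  concatMap (λ x → map (f x) ys) xs ≡ cartesianProductWith f xs ys
concatMap-map≡cartesianProductWith f []       ys = refl
concatMap-map≡cartesianProductWith f (x ∷ xs) ys =
  cong (map (f x) ys ++_) (concatMap-map≡cartesianProductWith f xs ys)

allWords-unique : ∀ q n → Unique (allWords q n)
allWords-unique q zero    = [] ∷ []
allWords-unique q (suc n) =
  subst Unique (sym (concatMap-map≡cartesianProductWith _∷_ (allFin q) (allWords q n)))
    (Unique.cartesianProductWith⁺ _∷_ ∷-injective (Unique.allFin⁺ q) (allWords-unique q n))

length≤1 : ∀ {P : A → Set} {ys} → All P ys → Unique ys → (∀ {y z} → P y → P z → ¬ y ≢ z) → length ys ≤ 1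
length≤1 {ys = []}        _               _                 _ = z≤n
length≤1 {ys = _ ∷ []}    _               _                 _ = s≤s z≤n
length≤1 {ys = _ ∷ _ ∷ _} (py ∷ pz ∷ _) ((y≢z ∷ _) ∷ _) P-unique = ⊥-elim (P-unique py pz y≢z)

length≡0⊎length≡0 : ∀ {P Q : A → Set} {ys zs} → All P ys → All Q zs → (∀ {y z} → P y → Q z → ⊥) →
                    length ys ≡ 0 ⊎ length zs ≡ 0
length≡0⊎length≡0 []       _        _ = inj₁ refl
length≡0⊎length≡0 (_ ∷ _)  []       _ = inj₂ refl
length≡0⊎length≡0 (py ∷ _) (qz ∷ _) incompatible = ⊥-elim (incompatible py qz)

allPairs-restrict : ∀ {P : A → Set} {R S : A → A → Set} → (∀ {y z} → P y → P z → R y z → S y z) →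
                    ∀ {ys} → All P ys → AllPairs R ys → AllPairs S ys
allPairs-restrict R⇒S []        []        = []
allPairs-restrict R⇒S (py ∷ ps) (ry ∷ rs) =
  All.zipWith (λ (pz , r) → R⇒S py pz r) (ps , ry) ∷ allPairs-restrict R⇒S ps rs

module Spheres (Z : Code q n) (x : Word q n) where

  sphere : ℕ → List (Word q n)
  sphere i = filterᵇ (λ y → Z y ∧ (dist x y ≡ᵇ i)) (allWords q n)

  InSphere : ℕ → Word q n → Set
  InSphere i y = (Z y ≡ true) × (dist x y ≡ i)

  sphere-members : ∀ i → All (InSphere i) (sphere i)
  sphere-members i = All.map from-T (All.all-filter (T? ∘ λ y → Z y ∧ (dist x y ≡ᵇ i)) (allWords q n))
    where
    from-T : ∀ {y} → T (Z y ∧ (dist x y ≡ᵇ i)) → InSphere i y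
    from-T {y} t with Equivalence.to (T-∧ {Z y}) t
    ... | in-Z , at-i = Equivalence.to T-≡ in-Z , ℕ.≡ᵇ⇒≡ _ _ at-i

  sphere-unique : ∀ i → Unique (sphere i)
  sphere-unique i = Unique.filter⁺ _ (allWords-unique q n)

  module _ (min-dist : MinDist4 Z) where

    codewords-far : ∀ {i j y z} → InSphere i y → InSphere j z → y ≢ z → 4 ≤ i + j
    codewords-far {i} {j} {y} {z} (y∈Z , refl) (z∈Z , refl) y≢z =
      ℕ.≤-trans (min-dist y z y∈Z z∈Z y≢z) (dist-triangle x y z)

    length-sphere≤1 : ∀ i → i + i < 4 → length (sphere i) ≤ 1
    length-sphere≤1 i i+i<4 = length≤1 (sphere-members i) (sphere-unique i)
      (λ y∈S z∈S y≢z → ℕ.<⇒≱ i+i<4 (codewords-far y∈S z∈S y≢z))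

    length-sphere≡0⊎length-sphere≡0 : ∀ {i j} → i ≢ j → i + j < 4 →
                                       length (sphere i) ≡ 0 ⊎ length (sphere j) ≡ 0
    length-sphere≡0⊎length-sphere≡0 i≢j i+j<4 = length≡0⊎length≡0 (sphere-members _) (sphere-members _)
      (λ y∈S z∈S → ℕ.<⇒≱ i+j<4 (codewords-far y∈S z∈S (λ { refl → i≢j (trans (sym (proj₂ y∈S)) (proj₂ z∈S)) })))

    length-sphere-2 : 2 * length (sphere 2) ≤ n
    length-sphere-2 = begin
      2 * length (sphere 2)            ≡⟨ ℕ.*-comm 2 (length (sphere 2)) ⟩
      length (sphere 2) * 2            ≡⟨ sum-map-const (dist x) (All.map proj₂ (sphere-members 2)) ⟨
      sum (map (dist x) (sphere 2))    ≤⟨ sum-dist-≤ x (allPairs-restrict between (sphere-members 2) (sphere-unique 2)) ⟩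
      n                                ∎
      where
      open ℕ.≤-Reasoning
      between : ∀ {y z} → InSphere 2 y → InSphere 2 z → y ≢ z → Between x y z
      between {y} {z} (y∈Z , dy) (z∈Z , dz) y≢z rewrite dy | dz = min-dist y z y∈Z z∈Z y≢z

fromℚᵘ-mono-≤ : ∀ {p q : ℚᵘ} → p ℚᵘ.≤ q → ℚ.fromℚᵘ p ℚ.≤ ℚ.fromℚᵘ q
fromℚᵘ-mono-≤ {p} {q} p≤q = ℚ.toℚᵘ-cancel-≤
  (ℚᵘ.≤-respˡ-≃ (ℚᵘ.≃-sym (ℚ.toℚᵘ-fromℚᵘ p)) (ℚᵘ.≤-respʳ-≃ (ℚᵘ.≃-sym (ℚ.toℚᵘ-fromℚᵘ q)) p≤q))

m/n≤1 : ∀ {m n} .{{_ : NonZero n}} → m ≤ n → + m / n ℚ.≤ 1ℚ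
m/n≤1 {m} {suc k} m≤n = fromℚᵘ-mono-≤ {mkℚᵘ (+ m) k} {ℚᵘ.1ℚᵘ} (*≤* (begin
  + m ℤ.* + 1     ≡⟨ ℤ.*-identityʳ (+ m) ⟩
  + m             ≤⟨ ℤ.+≤+ m≤n ⟩
  + suc k         ≡⟨ ℤ.*-identityˡ (+ suc k) ⟨
  + 1 ℤ.* + suc k ∎))
  where open ℤ.≤-Reasoning

m/n≡1⇒m≡n : ∀ {m n} .{{_ : NonZero n}} → + m / n ≡ 1ℚ → m ≡ n
m/n≡1⇒m≡n {m} {suc k} m/n≡1 with ℚ./-injective-≃ (mkℚᵘ (+ m) k) ℚᵘ.1ℚᵘ m/n≡1
... | *≡* m*1≡1*n = ℤ.+-injective (begin
  + m             ≡⟨ ℤ.*-identityʳ (+ m) ⟨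
  + m ℤ.* + 1     ≡⟨ m*1≡1*n ⟩
  + 1 ℤ.* + suc k ≡⟨ ℤ.*-identityˡ (+ suc k) ⟩
  + suc k         ∎)
  where open ≡-Reasoning

m/1≡n/2 : ∀ {m n} → 2 * m ≡ n → + m / 1 ≡ + n / 2
m/1≡n/2 {m} {n} 2m≡n = ℚ.fromℚᵘ-cong {mkℚᵘ (+ m) 0} {mkℚᵘ (+ n) 1} (*≡* (begin
  + m ℤ.* + 2 ≡⟨ ℤ.pos-* m 2 ⟨
  + (m * 2)   ≡⟨ cong +_ (trans (ℕ.*-comm m 2) 2m≡n) ⟩
  + n         ≡⟨ ℤ.*-identityʳ (+ n) ⟨
  + n ℤ.* + 1 ∎))
  where open ≡-Reasoning

weight : (n a b c : ℕ) .{{_ : NonZero n}} → ℚ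
weight n a b c = + (a + b) / 1 +ℚ + (2 * c) / n

data Profile (n : ℕ) : ℕ → ℕ → ℕ → Set where
  codeword   : Profile n 1 0 0
  adjacent   : Profile n 0 1 0
  distance-2 : ∀ {c} → 2 * c ≤ n → Profile n 0 0 c

profile : ∀ {n a b c} → a ≤ 1 → b ≤ 1 → a ≡ 0 ⊎ b ≡ 0 → a ≡ 0 ⊎ c ≡ 0 → b ≡ 0 ⊎ c ≡ 0 →
          2 * c ≤ n → Profile n a b c
profile {a = 0} {0}           _        _        _         _         _         2c≤n = distance-2 2c≤n
profile {a = 1} {0} {0}       _        _        _         _         _         _    = codeword
profile {a = 0} {1} {0}       _        _        _         _         _         _    = adjacent
profile {a = 1} {0} {suc _}   _        _        _         (inj₁ ()) _         _
profile {a = 1} {0} {suc _}   _        _        _         (inj₂ ()) _         _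
profile {a = 0} {1} {suc _}   _        _        _         _         (inj₁ ()) _
profile {a = 0} {1} {suc _}   _        _        _         _         (inj₂ ()) _
profile {a = 1} {1}           _        _        (inj₁ ()) _         _         _
profile {a = 1} {1}           _        _        (inj₂ ()) _         _         _
profile {a = suc (suc _)}     (s≤s ()) _        _         _         _         _
profile {a = 0} {suc (suc _)} _        (s≤s ()) _         _         _         _
profile {a = 1} {suc (suc _)} _        (s≤s ()) _         _         _         _

weight-codeword≡1 : ∀ n .{{_ : NonZero n}} → weight n 1 0 0 ≡ 1ℚ
weight-codeword≡1 n = trans (cong (1ℚ +ℚ_) (ℚ.0/n≡0 n)) (ℚ.+-identityʳ 1ℚ)

weight≤1 : ∀ {n a b c} .{{_ : NonZero n}} → Profile n a b c → weight n a b c ℚ.≤ 1ℚ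
weight≤1 {n} codeword      = ℚ.≤-reflexive (weight-codeword≡1 n)
weight≤1 {n} adjacent      = ℚ.≤-reflexive (weight-codeword≡1 n)
weight≤1 (distance-2 2c≤n) = subst (ℚ._≤ 1ℚ) (sym (ℚ.+-identityˡ _)) (m/n≤1 2c≤n)

exclusive-counts : ∀ {a b : ℕ} {X Y W : Set} →
  ¬ (((a ≡ 1) × (b ≡ 0) × X) × ((a ≡ 0) × (b ≡ 1) × Y)) ×
  ¬ (((a ≡ 1) × (b ≡ 0) × X) × ((a ≡ 0) × (b ≡ 0) × W)) ×
  ¬ (((a ≡ 0) × (b ≡ 1) × Y) × ((a ≡ 0) × (b ≡ 0) × W))
exclusive-counts =
  (λ { ((refl , _) , (() , _)) }) , (λ { ((refl , _) , (() , _)) }) , (λ { ((_ , refl , _) , (_ , () , _)) })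

weight≡1⇒exactlyOne : ∀ {n a b c} .{{_ : NonZero n}} → Profile n a b c → weight n a b c ≡ 1ℚ →
  ExactlyOne3 ((a ≡ 1) × (b ≡ 0) × (c ≡ 0))
              ((a ≡ 0) × (b ≡ 1) × (c ≡ 0))
              ((a ≡ 0) × (b ≡ 0) × (+ c / 1 ≡ + n / 2))
weight≡1⇒exactlyOne codeword _ = inj₁ (refl , refl , refl) , exclusive-counts
weight≡1⇒exactlyOne adjacent _ = inj₂ (inj₁ (refl , refl , refl)) , exclusive-counts
weight≡1⇒exactlyOne (distance-2 {c} _) weight≡1 =
  inj₂ (inj₂ (refl , refl , m/1≡n/2 {c} (m/n≡1⇒m≡n {2 * c} (trans (sym (ℚ.+-identityˡ _)) weight≡1)))) , exclusive-counts

lemma3 : (q n : ℕ) → q ≥ 3 → .{{_ : NonZero n}} → (Z : Code q n) → MinDist4 Z →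
  (x : Word q n) →
    (w Z x ℚ.≤ 1ℚ)
    × (w Z x ≡ 1ℚ →
        ExactlyOne3
          ((cnt Z 0 x ≡ 1) × (cnt Z 1 x ≡ 0) × (cnt Z 2 x ≡ 0))
          ((cnt Z 0 x ≡ 0) × (cnt Z 1 x ≡ 1) × (cnt Z 2 x ≡ 0))
          ((cnt Z 0 x ≡ 0) × (cnt Z 1 x ≡ 0) × ((+ cnt Z 2 x) / 1 ≡ (+ n) / 2)))
lemma3 q n _ Z min-dist x = weight≤1 counts , weight≡1⇒exactlyOne counts
  where
  open Spheres Z x
  counts : Profile n (cnt Z 0 x) (cnt Z 1 x) (cnt Z 2 x)
  counts = profile
    (length-sphere≤1 min-dist 0 z<s)
    (length-sphere≤1 min-dist 1 (s<s (s<s z<s)))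
    (length-sphere≡0⊎length-sphere≡0 min-dist (λ ()) (s<s z<s))
    (length-sphere≡0⊎length-sphere≡0 min-dist (λ ()) (s<s (s<s z<s)))
    (length-sphere≡0⊎length-sphere≡0 min-dist (λ ()) (s<s (s<s (s<s z<s))))
    (length-sphere-2 min-dist)
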